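{- Every tree-child network with $n$ leaves and $k$ reticulation nodes has exactly $n-k-1$ free tree nodes and thus exactly $2(n-k-1)$ free edges.
   Context: A (rooted, binary, leaf-labeled) phylogenetic network with $n$ leaves is a finite connected directed acyclic graph without parallel edges whose vertices are of four kinds: a root of indegree $0$ and outdegree $1$; $n$ leaves of indegree $1$ and outdegree $0$, bijectively labeled by $\{1,\ldots,n\}$; tree nodes of indegree $1$ and outdegree $2$; and reticulation nodes of indegree $2$ and outdegree $1$. It is a tree-child network if every node that is not a leaf has at least one child that is not a reticulation node. A tree node is free if each of its children is a tree node or a leaf; a free edge is an edge from a free tree node to one of its children. -}

module Defs where

open import Data.Nat using (ℕ; zero; suc; _+_; _≡ᵇ_)
open import Data.Bool using (Bool; true; false; _∧_; _∨_; not; if_then_else_)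
open import Data.Fin using (Fin; zero; suc)
open import Data.Product using (Σ; _×_; ∃; _,_)
open import Data.Sum using (_⊎_)
open import Function using (_∘_)
open import Function.Definitions using (Injective)
open import Relation.Binary.PropositionalEquality using (_≡_)
open import Relation.Nullary using (¬_)
open import Relation.Binary.Construct.Closure.Transitive using (TransClosure)
open import Relation.Binary.Construct.Closure.ReflexiveTransitive using (Star)
open import Relation.Binary.Construct.Closure.Symmetric using (SymClosure)

count : ∀ {m} → (Fin m → Bool) → ℕ
count {zero}  p = 0
count {suc m} p = (if p zero then 1 else 0) + count (p ∘ suc)

sumFin : ∀ {m} → (Fin m → ℕ) → ℕ
sumFin {zero}  f = 0
sumFin {suc m} f = f zero + sumFin (f ∘ suc)

allFin? : ∀ {m} → (Fin m → Bool) → Bool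
allFin? {zero}  p = true
allFin? {suc m} p = p zero ∧ allFin? (p ∘ suc)

-- A finite directed graph without parallel edges on vertex set Fin m:
-- an edge u → v exists iff E u v ≡ true.
module Graph {m : ℕ} (E : Fin m → Fin m → Bool) where

  Edge : Fin m → Fin m → Set
  Edge u v = E u v ≡ true

  indeg : Fin m → ℕ
  indeg v = count (λ u → E u v)

  outdeg : Fin m → ℕ
  outdeg u = count (λ v → E u v)

  isLeaf isTree isRet : Fin m → Bool
  isLeaf v = (indeg v ≡ᵇ 1) ∧ (outdeg v ≡ᵇ 0)
  isTree v = (indeg v ≡ᵇ 1) ∧ (outdeg v ≡ᵇ 2)
  isRet  v = (indeg v ≡ᵇ 2) ∧ (outdeg v ≡ᵇ 1)

  isFree : Fin m → Bool
  isFree v = isTree v ∧ allFin? (λ w → not (E v w) ∨ isTree w ∨ isLeaf w)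

  Acyclic : Set
  Acyclic = ∀ v → ¬ TransClosure Edge v v

  Connected : Set
  Connected = ∀ u v → Star (SymClosure Edge) u v

record PhyloNetwork (n : ℕ) : Set₁ where
  field
    m     : ℕ
    E     : Fin m → Fin m → Bool
  open Graph E public
  field
    acyclic   : Acyclic
    connected : Connected
    root      : Fin m
    root-in   : indeg root ≡ 0
    root-out  : outdeg root ≡ 1
    kinds     : ∀ v → v ≡ root ⊎ isLeaf v ≡ true ⊎ isTree v ≡ true ⊎ isRet v ≡ true
    label     : Fin n → Fin m
    label-inj : Injective _≡_ _≡_ label
    label-img : ∀ v → isLeaf v ≡ true → ∃ λ i → label i ≡ v
    label-leaf : ∀ i → isLeaf (label i) ≡ true

  TreeChild : Set
  TreeChild = ∀ v → ¬ isLeaf v ≡ true → ∃ λ w → Edge v w × isRet w ≡ false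

  reticulations : ℕ
  reticulations = count isRet

  freeTreeNodes : ℕ
  freeTreeNodes = count isFree

  freeEdges : ℕ
  freeEdges = sumFin (λ u → if isFree u then count (E u) else 0)

module Submission where

-- Let N be a tree-child network with n leaves, k reticulations, t tree nodes
-- and f free tree nodes.  Both equations follow from double counting edges.
--
-- * Every vertex has one of the degree profiles (in, out) = (0,1), (1,0),
--   (1,2), (2,1), and each satisfies  out + [leaf] + [ret] = in + [tree] + [root].
--   Summed over all vertices, in- and out-degrees cancel, so n + k = t + 1
--   (the leaves are counted through their bijective labelling).
-- * In a tree-child network a vertex of out-degree at most 1 has no
--   reticulation child and a tree node has at most one; a tree node is free
--   exactly when it has none.  Counting the edges into reticulations (each of
--   in-degree 2) from both ends gives t = f + 2k.
-- Hence f + k + 1 = n; and a free tree node has out-degree 2, so there are 2f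
-- free edges.

open import Defs
open import Data.Nat using (ℕ; zero; suc; _+_; _*_; _≡ᵇ_; _≤_; _<_; z≤n; s≤s; s≤s⁻¹)
open import Data.Nat.Properties
  using ( *-zeroʳ; *-suc; *-identityʳ; ≤-trans; ≤-reflexive; <-≤-trans; m≤m+n; m≤n+m
        ; m<m+n; n≤0⇒n≡0; n<1⇒n≡0; ≡ᵇ⇒≡; +-cancelˡ-≡; +-cancelʳ-≡; +-commutativeSemigroup)
open import Data.Nat.Solver using (module +-*-Solver)
open import Algebra.Properties.CommutativeSemigroup +-commutativeSemigroup using (interchange)
open import Data.Bool using (Bool; true; false; _∧_; _∨_; not; if_then_else_; T)
open import Data.Bool.Properties using (∧-identityʳ; ∧-zeroʳ; ∧-assoc; ∧-idem; ∧-conicalˡ; ¬-not; not-¬)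
open import Data.Fin using (Fin; zero; suc; _≟_)
open import Data.Fin.Properties using (suc-injective; 0≢1+n)
open import Data.Product using (_×_; _,_; ∃)
open import Data.Sum using (inj₁; inj₂)
open import Function using (_∘_; case_of_)
open import Function.Definitions using (Injective)
open import Relation.Binary.PropositionalEquality
open import Relation.Nullary using (¬_; does; yes; no)
open import Relation.Nullary.Decidable using (dec-true; dec-false)

open ≡-Reasoning

⟦_⟧ : Bool → ℕ
⟦ b ⟧ = if b then 1 else 0

count-cong : ∀ {m} {p q : Fin m → Bool} → (∀ i → p i ≡ q i) → count p ≡ count q
count-cong {zero}  p≗q = refl
count-cong {suc m} p≗q = cong₂ _+_ (cong ⟦_⟧ (p≗q zero)) (count-cong (p≗q ∘ suc))

sumFin-cong : ∀ {m} {f g : Fin m → ℕ} → (∀ i → f i ≡ g i) → sumFin f ≡ sumFin g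
sumFin-cong {zero}  f≗g = refl
sumFin-cong {suc m} f≗g = cong₂ _+_ (f≗g zero) (sumFin-cong (f≗g ∘ suc))

allFin?-cong : ∀ {m} {p q : Fin m → Bool} → (∀ i → p i ≡ q i) → allFin? p ≡ allFin? q
allFin?-cong {zero}  p≗q = refl
allFin?-cong {suc m} p≗q = cong₂ _∧_ (p≗q zero) (allFin?-cong (p≗q ∘ suc))

sumFin-+ : ∀ {m} (f g : Fin m → ℕ) → sumFin (λ i → f i + g i) ≡ sumFin f + sumFin g
sumFin-+ {zero}  f g = refl
sumFin-+ {suc m} f g =
  trans (cong (f zero + g zero +_) (sumFin-+ (f ∘ suc) (g ∘ suc)))
        (interchange (f zero) (g zero) (sumFin (f ∘ suc)) (sumFin (g ∘ suc)))

sumFin-const : ∀ m c → sumFin {m} (λ _ → c) ≡ m * c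
sumFin-const zero    c = refl
sumFin-const (suc m) c = cong (c +_) (sumFin-const m c)

count-as-sum : ∀ {m} (p : Fin m → Bool) → count p ≡ sumFin (λ i → ⟦ p i ⟧)
count-as-sum {zero}  p = refl
count-as-sum {suc m} p = cong (⟦ p zero ⟧ +_) (count-as-sum (p ∘ suc))

sumFin-if : ∀ {m} c (p : Fin m → Bool) → sumFin (λ i → if p i then c else 0) ≡ c * count p
sumFin-if {zero}  c p = sym (*-zeroʳ c)
sumFin-if {suc m} c p with p zero
... | true  = trans (cong (c +_) (sumFin-if c (p ∘ suc))) (sym (*-suc c _))
... | false = sumFin-if c (p ∘ suc)

sumFin-+-indicators : ∀ {m} (f : Fin m → ℕ) (p q : Fin m → Bool) →
                      sumFin (λ v → f v + (⟦ p v ⟧ + ⟦ q v ⟧)) ≡ sumFin f + (count p + count q)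
sumFin-+-indicators f p q = begin
  sumFin (λ v → f v + (⟦ p v ⟧ + ⟦ q v ⟧))
    ≡⟨ sumFin-+ f (λ v → ⟦ p v ⟧ + ⟦ q v ⟧) ⟩
  sumFin f + sumFin (λ v → ⟦ p v ⟧ + ⟦ q v ⟧)
    ≡⟨ cong (sumFin f +_) (sumFin-+ (λ v → ⟦ p v ⟧) (λ v → ⟦ q v ⟧)) ⟩
  sumFin f + (sumFin (λ v → ⟦ p v ⟧) + sumFin (λ v → ⟦ q v ⟧))
    ≡⟨ cong (sumFin f +_) (cong₂ _+_ (count-as-sum p) (count-as-sum q)) ⟨
  sumFin f + (count p + count q) ∎

double-count : ∀ {a b} (R : Fin a → Fin b → Bool) →
               sumFin (λ u → count (R u)) ≡ sumFin (λ w → count (λ u → R u w))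
double-count {zero}  {b} R = sym (trans (sumFin-const b 0) (*-zeroʳ b))
double-count {suc a}     R = begin
  count (R zero) + sumFin (λ u → count (R (suc u)))
    ≡⟨ cong₂ _+_ (count-as-sum (R zero)) (double-count (R ∘ suc)) ⟩
  sumFin (λ w → ⟦ R zero w ⟧) + sumFin (λ w → count (λ u → R (suc u) w))
    ≡⟨ sumFin-+ (λ w → ⟦ R zero w ⟧) (λ w → count (λ u → R (suc u) w)) ⟨
  sumFin (λ w → count (λ u → R u w)) ∎

count-split : ∀ {m} (p q : Fin m → Bool) →
              count p ≡ count (λ i → p i ∧ q i) + count (λ i → p i ∧ not (q i))
count-split p q = begin
  count p
    ≡⟨ count-as-sum p ⟩
  sumFin (λ i → ⟦ p i ⟧)
    ≡⟨ sumFin-cong (λ i → split (p i) (q i)) ⟩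
  sumFin (λ i → ⟦ p i ∧ q i ⟧ + ⟦ p i ∧ not (q i) ⟧)
    ≡⟨ sumFin-+ (λ i → ⟦ p i ∧ q i ⟧) (λ i → ⟦ p i ∧ not (q i) ⟧) ⟩
  sumFin (λ i → ⟦ p i ∧ q i ⟧) + sumFin (λ i → ⟦ p i ∧ not (q i) ⟧)
    ≡⟨ cong₂ _+_ (count-as-sum (λ i → p i ∧ q i)) (count-as-sum (λ i → p i ∧ not (q i))) ⟨
  count (λ i → p i ∧ q i) + count (λ i → p i ∧ not (q i)) ∎
  where
  split : ∀ a b → ⟦ a ⟧ ≡ ⟦ a ∧ b ⟧ + ⟦ a ∧ not b ⟧
  split false _     = refl
  split true  true  = refl
  split true  false = refl

count-pos : ∀ {m} (p : Fin m → Bool) i → p i ≡ true → 0 < count p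
count-pos p zero    pi rewrite pi = s≤s z≤n
count-pos p (suc i) pi = <-≤-trans (count-pos (p ∘ suc) i pi) (m≤n+m _ _)

count-none : ∀ {m} (p : Fin m → Bool) → (∀ i → p i ≡ false) → count p ≡ 0
count-none {zero}  p none = refl
count-none {suc m} p none rewrite none zero = count-none (p ∘ suc) (none ∘ suc)

count-unique : ∀ {m} (p : Fin m → Bool) r → p r ≡ true → (∀ i → p i ≡ true → i ≡ r) → count p ≡ 1
count-unique p zero pr only rewrite pr =
  cong suc (count-none (p ∘ suc) (λ i → ¬-not (λ pi → 0≢1+n (sym (only (suc i) pi)))))
count-unique p (suc r) pr only rewrite ¬-not {p zero} (λ p0 → 0≢1+n (only zero p0)) =
  count-unique (p ∘ suc) r pr (λ i pi → suc-injective (only (suc i) pi))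

count-∧-≤ : ∀ {m} (p q : Fin m → Bool) → count (λ i → p i ∧ q i) ≤ count p
count-∧-≤ p q = ≤-trans (m≤m+n _ _) (≤-reflexive (sym (count-split p q)))

count-∧-< : ∀ {m} (p q : Fin m → Bool) {w} → p w ≡ true → q w ≡ false →
            count (λ i → p i ∧ q i) < count p
count-∧-< p q {w} pw qw = <-≤-trans
  (m<m+n _ (count-pos (λ i → p i ∧ not (q i)) w (cong₂ (λ a b → a ∧ not b) pw qw)))
  (≤-reflexive (sym (count-split p q)))

allFin?-none : ∀ {m} (p : Fin m → Bool) → allFin? (λ i → not (p i)) ≡ (count p ≡ᵇ 0)
allFin?-none {zero}  p = refl
allFin?-none {suc m} p with p zero
... | true  = refl
... | false = allFin?-none (p ∘ suc)

≟-sound : ∀ {m} {x y : Fin m} → does (x ≟ y) ≡ true → x ≡ y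
≟-sound {x = x} {y} h with x ≟ y
... | yes x≡y = x≡y
... | no  _   = case h of λ ()

count-image : ∀ {n m} (p : Fin m → Bool) (f : Fin n → Fin m) → Injective _≡_ _≡_ f →
              (∀ v → p v ≡ true → ∃ λ i → f i ≡ v) → (∀ i → p (f i) ≡ true) → count p ≡ n
count-image {n} {m} p f inj onto into = begin
  count p                                 ≡⟨ count-as-sum p ⟩
  sumFin (λ v → ⟦ p v ⟧)                  ≡⟨ sumFin-cong column ⟨
  sumFin (λ v → count (λ i → hits i v))   ≡⟨ double-count hits ⟨
  sumFin (λ i → count (hits i))           ≡⟨ sumFin-cong row ⟩
  sumFin {n} (λ _ → 1)                    ≡⟨ sumFin-const n 1 ⟩
  n * 1                                   ≡⟨ *-identityʳ n ⟩
  n                                       ∎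
  where
  hits : Fin n → Fin m → Bool
  hits i v = does (f i ≟ v)

  row : ∀ i → count (hits i) ≡ 1
  row i = count-unique (hits i) (f i) (dec-true (f i ≟ f i) refl) (λ v h → sym (≟-sound h))

  column : ∀ v → count (λ i → hits i v) ≡ ⟦ p v ⟧
  column v with p v in pv
  ... | true  = let (i , fi≡v) = onto v pv in
                count-unique (λ i → hits i v) i (dec-true (f i ≟ v) fi≡v) (λ j h → inj (trans (≟-sound h) (sym fi≡v)))
  ... | false = count-none (λ i → hits i v) (λ i → dec-false (f i ≟ v) (λ fi≡v →
                  case trans (sym pv) (subst (λ v → p v ≡ true) fi≡v (into i)) of λ ()))

leafDeg treeDeg retDeg : ℕ → ℕ → Bool
leafDeg i o = (i ≡ᵇ 1) ∧ (o ≡ᵇ 0)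
treeDeg i o = (i ≡ᵇ 1) ∧ (o ≡ᵇ 2)
retDeg  i o = (i ≡ᵇ 2) ∧ (o ≡ᵇ 1)

data Profile : ℕ → ℕ → Set where
  root-p : Profile 0 1
  leaf-p : Profile 1 0
  tree-p : Profile 1 2
  ret-p  : Profile 2 1

-- a vertex of a given kind has its profile (for other degrees the hypothesis is false ≡ true)
leaf-profile : ∀ {i o} → leafDeg i o ≡ true → Profile i o
leaf-profile {1} {0} _ = leaf-p

tree-profile : ∀ {i o} → treeDeg i o ≡ true → Profile i o
tree-profile {1} {2} _ = tree-p

ret-profile : ∀ {i o} → retDeg i o ≡ true → Profile i o
ret-profile {2} {1} _ = ret-p

degree-balance : ∀ {i o} → Profile i o →
                 o + (⟦ leafDeg i o ⟧ + ⟦ retDeg i o ⟧) ≡ i + (⟦ treeDeg i o ⟧ + ⟦ i ≡ᵇ 0 ⟧)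
degree-balance root-p = refl
degree-balance leaf-p = refl
degree-balance tree-p = refl
degree-balance ret-p  = refl

non-root-kinds : ∀ {i o} → Profile i o → 0 < i → treeDeg i o ∨ leafDeg i o ≡ not (retDeg i o)
non-root-kinds leaf-p _ = refl
non-root-kinds tree-p _ = refl
non-root-kinds ret-p  _ = refl

leaf-outdeg : ∀ {i o} → Profile i o → leafDeg i o ≡ true → o ≡ 0
leaf-outdeg leaf-p _ = refl

tree-outdeg : ∀ {i o} → Profile i o → treeDeg i o ≡ true → o ≡ 2
tree-outdeg tree-p _ = refl

tree-not-leaf : ∀ {i o} → Profile i o → treeDeg i o ≡ true → leafDeg i o ≡ false
tree-not-leaf tree-p _ = refl

non-tree-outdeg : ∀ {i o} → Profile i o → treeDeg i o ≡ false → o ≤ 1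
non-tree-outdeg root-p _ = s≤s z≤n
non-tree-outdeg leaf-p _ = z≤n
non-tree-outdeg ret-p  _ = s≤s z≤n

ret-indeg : ∀ {i o} → Profile i o → retDeg i o ≡ true → i ≡ 2
ret-indeg ret-p _ = refl

free-arith : ∀ {l r t f} → l + r ≡ t + 1 → t ≡ f + 2 * r → f + r + 1 ≡ l
free-arith {l} {r} {t} {f} balance split = +-cancelʳ-≡ r (f + r + 1) l (begin
  f + r + 1 + r  ≡⟨ rearrange f r ⟩
  f + 2 * r + 1  ≡⟨ cong (_+ 1) split ⟨
  t + 1          ≡⟨ balance ⟨
  l + r          ∎)
  where
  open +-*-Solver
  rearrange : ∀ f r → f + r + 1 + r ≡ f + 2 * r + 1
  rearrange = solve 2 (λ f r → f :+ r :+ con 1 :+ r := f :+ con 2 :* r :+ con 1) refl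

module Network {n : ℕ} (N : PhyloNetwork n) where
  open PhyloNetwork N

  profile : ∀ v → Profile (indeg v) (outdeg v)
  profile v with kinds v
  ... | inj₁ refl               = subst₂ Profile (sym root-in) (sym root-out) root-p
  ... | inj₂ (inj₁ leaf)        = leaf-profile {indeg v} {outdeg v} leaf
  ... | inj₂ (inj₂ (inj₁ tree)) = tree-profile {indeg v} {outdeg v} tree
  ... | inj₂ (inj₂ (inj₂ ret))  = ret-profile {indeg v} {outdeg v} ret

  root-unique : ∀ v → indeg v ≡ 0 → v ≡ root
  root-unique v h with kinds v
  ... | inj₁ v≡root             = v≡root
  ... | inj₂ (inj₁ leaf)        = case subst (λ i → leafDeg i (outdeg v) ≡ true) h leaf of λ ()
  ... | inj₂ (inj₂ (inj₁ tree)) = case subst (λ i → treeDeg i (outdeg v) ≡ true) h tree of λ ()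
  ... | inj₂ (inj₂ (inj₂ ret))  = case subst (λ i → retDeg i (outdeg v) ≡ true) h ret of λ ()

  root-count : count (λ v → indeg v ≡ᵇ 0) ≡ 1
  root-count = count-unique (λ v → indeg v ≡ᵇ 0) root (cong (_≡ᵇ 0) root-in)
    (λ v h → root-unique v (≡ᵇ⇒≡ (indeg v) 0 (subst T (sym h) _)))

  head-indeg : ∀ {u w} → E u w ≡ true → 0 < indeg w
  head-indeg {u} {w} e = count-pos (λ x → E x w) u e

  leaf-count : count isLeaf ≡ n
  leaf-count = count-image isLeaf label label-inj label-img label-leaf

  leaf-ret-balance : count isLeaf + count isRet ≡ count isTree + 1
  leaf-ret-balance = +-cancelˡ-≡ (sumFin outdeg) _ _ (begin
    sumFin outdeg + (count isLeaf + count isRet)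
      ≡⟨ sumFin-+-indicators outdeg isLeaf isRet ⟨
    sumFin (λ v → outdeg v + (⟦ isLeaf v ⟧ + ⟦ isRet v ⟧))
      ≡⟨ sumFin-cong (λ v → degree-balance (profile v)) ⟩
    sumFin (λ v → indeg v + (⟦ isTree v ⟧ + ⟦ indeg v ≡ᵇ 0 ⟧))
      ≡⟨ sumFin-+-indicators indeg isTree (λ v → indeg v ≡ᵇ 0) ⟩
    sumFin indeg + (count isTree + count (λ v → indeg v ≡ᵇ 0))
      ≡⟨ cong₂ _+_ (sym (double-count E)) (cong (count isTree +_) root-count) ⟩
    sumFin outdeg + (count isTree + 1) ∎)

  free-edge-count : freeEdges ≡ 2 * freeTreeNodes
  free-edge-count = trans (sumFin-cong two-children) (sumFin-if 2 isFree)
    where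
    two-children : ∀ u → (if isFree u then count (E u) else 0) ≡ (if isFree u then 2 else 0)
    two-children u with isFree u in free
    ... | true  = tree-outdeg (profile u) (∧-conicalˡ _ _ free)
    ... | false = refl

  retChildren : Fin m → ℕ
  retChildren u = count (λ w → E u w ∧ isRet w)

  ret-parents : ∀ w → count (λ u → E u w ∧ isRet w) ≡ (if isRet w then 2 else 0)
  ret-parents w with isRet w in ret
  ... | true  = trans (count-cong (λ u → ∧-identityʳ (E u w))) (ret-indeg (profile w) ret)
  ... | false = count-none _ (λ u → ∧-zeroʳ (E u w))

  childrenTreeOrLeaf : Fin m → Bool
  childrenTreeOrLeaf u = allFin? (λ w → not (E u w) ∨ isTree w ∨ isLeaf w)

  child-kinds : ∀ u w → (not (E u w) ∨ isTree w ∨ isLeaf w) ≡ not (E u w ∧ isRet w)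
  child-kinds u w with E u w in e
  ... | false = refl
  ... | true  = non-root-kinds (profile w) (head-indeg e)

  free-iff : ∀ u → isFree u ≡ isTree u ∧ (retChildren u ≡ᵇ 0)
  free-iff u = cong (isTree u ∧_)
    (trans (allFin?-cong (child-kinds u)) (allFin?-none (λ w → E u w ∧ isRet w)))

  tree-split : count isTree ≡ freeTreeNodes + count (λ u → isTree u ∧ not (isFree u))
  tree-split = trans (count-split isTree isFree)
    (cong (_+ count (λ u → isTree u ∧ not (isFree u))) (count-cong tree∧free))
    where
    tree∧free : ∀ u → isTree u ∧ isFree u ≡ isFree u
    tree∧free u = trans (sym (∧-assoc (isTree u) (isTree u) (childrenTreeOrLeaf u)))
                        (cong (_∧ childrenTreeOrLeaf u) (∧-idem (isTree u)))

  module _ (tree-child : TreeChild) where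

    -- a non-leaf has a non-reticulation child, hence fewer reticulation children than children
    retChildren<outdeg : ∀ u → ¬ isLeaf u ≡ true → retChildren u < outdeg u
    retChildren<outdeg u not-leaf =
      let (_ , e , not-ret) = tree-child u not-leaf in count-∧-< (E u) isRet e not-ret

    low-outdeg : ∀ u → outdeg u ≤ 1 → retChildren u ≡ 0
    low-outdeg u ≤1 with isLeaf u in leaf
    ... | true  = n≤0⇒n≡0 (≤-trans (count-∧-≤ (E u) isRet) (≤-reflexive (leaf-outdeg (profile u) leaf)))
    ... | false = n<1⇒n≡0 (<-≤-trans (retChildren<outdeg u (not-¬ leaf)) ≤1)

    tree-retChildren : ∀ u → isTree u ≡ true → retChildren u ≤ 1
    tree-retChildren u tree = s≤s⁻¹ (subst (retChildren u <_) (tree-outdeg (profile u) tree)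
      (retChildren<outdeg u (not-¬ (tree-not-leaf (profile u) tree))))

    retChildren-indicator : ∀ u → retChildren u ≡ ⟦ isTree u ∧ not (isFree u) ⟧
    retChildren-indicator u rewrite free-iff u with isTree u in tree
    ... | true  = at-most-one (tree-retChildren u tree)
      where
      at-most-one : ∀ {x} → x ≤ 1 → x ≡ ⟦ not (x ≡ᵇ 0) ⟧
      at-most-one z≤n       = refl
      at-most-one (s≤s z≤n) = refl
    ... | false = low-outdeg u (non-tree-outdeg (profile u) tree)

    -- counting the edges into reticulations from both ends: t - f = 2k
    non-free-count : count (λ u → isTree u ∧ not (isFree u)) ≡ 2 * count isRet
    non-free-count = begin
      count (λ u → isTree u ∧ not (isFree u))
        ≡⟨ count-as-sum (λ u → isTree u ∧ not (isFree u)) ⟩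
      sumFin (λ u → ⟦ isTree u ∧ not (isFree u) ⟧)
        ≡⟨ sumFin-cong retChildren-indicator ⟨
      sumFin retChildren
        ≡⟨ double-count (λ u w → E u w ∧ isRet w) ⟩
      sumFin (λ w → count (λ u → E u w ∧ isRet w))
        ≡⟨ sumFin-cong ret-parents ⟩
      sumFin (λ w → if isRet w then 2 else 0)
        ≡⟨ sumFin-if 2 isRet ⟩
      2 * count isRet ∎

    free-node-count : freeTreeNodes + reticulations + 1 ≡ n
    free-node-count = trans (free-arith leaf-ret-balance (trans tree-split (cong (freeTreeNodes +_) non-free-count)))
                            leaf-count

lemma1 : ∀ (n k : ℕ) (N : PhyloNetwork n) → PhyloNetwork.TreeChild N → PhyloNetwork.reticulations N ≡ k → (PhyloNetwork.freeTreeNodes N + k + 1 ≡ n) × (PhyloNetwork.freeEdges N ≡ 2 * PhyloNetwork.freeTreeNodes N)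
lemma1 n k N tree-child refl = free-node-count tree-child , free-edge-count
  where open Network N
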